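{- Let $g\ge 1$ and let $D$ be a maximal chord diagram with $2g$ chords, whose $4g$ points are labelled $1,2,\dots,4g$ in cyclic order around the circle. Suppose $D$ is of type II, i.e. $D$ is invariant under the reflection $\rho$ of the circle whose axis passes through the midpoints of the arc between points $4g$ and $1$ and of the arc between points $2g$ and $2g+1$. Then $D$ contains no horizontal chord, i.e. no chord whose two endpoints are interchanged by $\rho$.
   Context: A chord diagram with $n$ chords is a circle with $2n$ evenly spaced points on its circumference, partitioned into $n$ pairs, each pair joined by a chord. Gluing the sides of a $2n$-gon according to the chords (each pair of sides glued without a twist) yields a one-face map on a closed orientable surface; the genus of the diagram is the genus of this surface. A diagram with $2g$ chords and genus $g$ is called maximal. A face-walk of a chord diagram is a cyclic sequence of alternating circle arcs (between consecutive points) and chord sides obtained by traversing the diagram: walking along an arc to its endpoint, then along the side of the chord at that endpoint to its other end, then continuing along the next arc, and so on. Face-walks correspond to the vertices of the glued one-face map (equivalently, to the cycles of $\sigma\tau$, where $\sigma$ is the cyclic rotation $i\mapsto i+1$ of the points and $\tau$ is the involution exchanging the endpoints of each chord); a diagram with $2g$ chords is maximal if and only if it has exactly one face-walk. For a reflection $\rho$ of the circle preserving a diagram, a vertical chord is a chord lying on the axis of $\rho$, and a horizontal chord is a chord whose two endpoints are interchanged by $\rho$. -}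

module Defs where

open import Data.Nat using (ℕ; zero; suc; _*_)
open import Data.Nat.DivMod using (_mod_)
open import Data.Fin using (Fin; toℕ; opposite)
open import Data.Product using (∃)
open import Relation.Binary.PropositionalEquality using (_≡_; _≢_)

-- Points of the circle: Fin n, where the point labelled i (1 ≤ i ≤ n)
-- in the paper is the element with toℕ = i - 1.

σ : ∀ {n} → Fin n → Fin n
σ {suc m} i = suc (toℕ i) mod suc m

iter : ∀ {A : Set} → (A → A) → ℕ → A → A
iter f zero    x = x
iter f (suc k) x = f (iter f k x)

-- A chord diagram on n points: a fixed-point-free involution τ
-- exchanging the two endpoints of each chord.
record ChordDiagram (n : ℕ) : Set where
  field
    τ         : Fin n → Fin n
    involutive : ∀ x → τ (τ x) ≡ x
    noFixed   : ∀ x → τ x ≢ x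
open ChordDiagram public

-- Face-walks are the cycles of σ ∘ τ.  Exactly one face-walk means
-- σ ∘ τ acts transitively (is a single cycle) on the points.
OneFaceWalk : ∀ {n} → ChordDiagram n → Set
OneFaceWalk {n} D = ∀ (x y : Fin n) → ∃ λ k → iter (λ z → σ (τ D z)) k x ≡ y

-- A diagram with 2g chords (4g points) is maximal iff it has one face-walk.
Maximal : ∀ (g : ℕ) → ChordDiagram (4 * g) → Set
Maximal g D = OneFaceWalk D

-- The type-II reflection: label i ↦ 4g + 1 - i, i.e. 0-based j ↦ 4g - 1 - j.
ρ : ∀ {n} → Fin n → Fin n
ρ = opposite

InvariantUnder : ∀ {n} → (Fin n → Fin n) → ChordDiagram n → Set
InvariantUnder {n} r D = ∀ (x : Fin n) → τ D (r x) ≡ r (τ D x)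

HasHorizontalChord : ∀ {n} → ChordDiagram n → Set
HasHorizontalChord {n} D = ∃ λ (x : Fin n) → τ D x ≡ ρ x

-- Write φ = σ ∘ τ for the face-walk permutation and μ = σ ∘ ρ.  Since
-- σ ∘ ρ ∘ σ = ρ and τ commutes with ρ, φ ∘ μ ∘ φ = μ, hence
-- φᵏ ∘ μ ∘ φᵏ = μ for every k.  If x = φᵏ(0) is an endpoint of a horizontal
-- chord, then τ x = ρ x, so φ²ᵏ⁺¹(0) = φᵏ(μ(φᵏ(0))) = μ(0) = 0.  But in a
-- maximal diagram φ is a single cycle of length 4g, so 4g would divide the
-- odd number 2k + 1.
module Submission where

open import Defs
open import Data.Nat using (ℕ; _*_; _≤_)
open import Relation.Nullary using (¬_)

open import Data.Nat.Base using (zero; suc; _+_; _∸_; _<_; _/_; _%_; NonZero; >-nonZero; z≤n; s≤s)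
open import Data.Nat.Properties
open import Data.Nat.DivMod using (m≡m%n+[m/n]*n; m%n<n; m<n⇒m%n≡m; n%n≡0)
open import Data.Nat.Divisibility using (_∣_; _∤_; divides; ∣-trans; m∣m*n; m%n≡0⇒n∣m)
open import Data.Fin.Base as Fin using (Fin; toℕ; fromℕ<)
open import Data.Fin.Properties
  using (toℕ-injective; toℕ-fromℕ<; toℕ≤pred[n]; opposite-prop; opposite-involutive; injective⇒≤; pigeonhole)
open import Data.Product using (∃; _,_; _×_; proj₁; proj₂)
open import Data.Sum using (inj₁; inj₂)
open import Data.Empty using (⊥-elim)
open import Function.Definitions using (Injective)
open import Relation.Binary.PropositionalEquality
open ≡-Reasoning

iter-+ : ∀ {A : Set} (f : A → A) m n x → iter f (m + n) x ≡ iter f m (iter f n x)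
iter-+ f zero    n x = refl
iter-+ f (suc m) n x = cong f (iter-+ f m n x)

iter-suc : ∀ {A : Set} (f : A → A) k x → iter f (suc k) x ≡ iter f k (f x)
iter-suc f zero    x = refl
iter-suc f (suc k) x = cong f (iter-suc f k x)

iter-* : ∀ {A : Set} (f : A → A) {m z} → iter f m z ≡ z → ∀ q → iter f (q * m) z ≡ z
iter-* f         e zero    = refl
iter-* f {m} {z} e (suc q) = begin
  iter f (m + q * m) z        ≡⟨ iter-+ f m (q * m) z ⟩
  iter f m (iter f (q * m) z) ≡⟨ cong (iter f m) (iter-* f e q) ⟩
  iter f m z                  ≡⟨ e ⟩
  z                           ∎

iter-injective : ∀ {A : Set} {f : A → A} → Injective _≡_ _≡_ f → ∀ k → Injective _≡_ _≡_ (iter f k)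
iter-injective f-inj zero    e = e
iter-injective f-inj (suc k) e = iter-injective f-inj k (f-inj e)

iter-reverses : ∀ {A : Set} (f μ : A → A) → (∀ y → f (μ (f y)) ≡ μ y) →
                ∀ k y → iter f k (μ (iter f k y)) ≡ μ y
iter-reverses f μ reverses zero    y = refl
iter-reverses f μ reverses (suc k) y = begin
  iter f (suc k) (μ (f (iter f k y))) ≡⟨ iter-suc f k _ ⟩
  iter f k (f (μ (f (iter f k y))))   ≡⟨ cong (iter f k) (reverses (iter f k y)) ⟩
  iter f k (μ (iter f k y))           ≡⟨ iter-reverses f μ reverses k y ⟩
  μ y                                 ∎

module Orbit {n : ℕ} (f : Fin (suc n) → Fin (suc n)) (f-injective : Injective _≡_ _≡_ f)
             (z : Fin (suc n)) where

  Period : ℕ → Set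
  Period m = iter f m z ≡ z

  Covers : Set
  Covers = ∀ y → ∃ λ k → iter f k z ≡ y

  iter-% : ∀ {m} .{{_ : NonZero m}} → Period m → ∀ k → iter f k z ≡ iter f (k % m) z
  iter-% {m} per k = begin
    iter f k z                              ≡⟨ cong (λ j → iter f j z) (m≡m%n+[m/n]*n k m) ⟩
    iter f (k % m + (k / m) * m) z          ≡⟨ iter-+ f (k % m) ((k / m) * m) z ⟩
    iter f (k % m) (iter f ((k / m) * m) z) ≡⟨ cong (iter f (k % m)) (iter-* f per (k / m)) ⟩
    iter f (k % m) z                        ∎

  period-∸ : ∀ {a b} → a ≤ b → iter f a z ≡ iter f b z → Period (b ∸ a)
  period-∸ {a} {b} a≤b e = iter-injective f-injective a (begin
    iter f a (iter f (b ∸ a) z) ≡⟨ iter-+ f a (b ∸ a) z ⟨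
    iter f (a + (b ∸ a)) z      ≡⟨ cong (λ k → iter f k z) (m+[n∸m]≡n a≤b) ⟩
    iter f b z                  ≡⟨ e ⟨
    iter f a z                  ∎)

  short-period : ∃ λ p → 0 < p × p ≤ suc n × Period p
  short-period with i , j , i<j , e ← pigeonhole (n<1+n (suc n)) (λ i → iter f (toℕ i) z) =
    toℕ j ∸ toℕ i , m<n⇒0<n∸m i<j , ≤-trans (m∸n≤m (toℕ j) (toℕ i)) (toℕ≤pred[n] j) , period-∸ (<⇒≤ i<j) e

  suc-n≤period : Covers → ∀ {m} .{{_ : NonZero m}} → Period m → suc n ≤ m
  suc-n≤period covers {m} per = injective⇒≤ index-injective
    where
    index : Fin (suc n) → Fin m
    index y = fromℕ< (m%n<n (proj₁ (covers y)) m)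

    iter-index : ∀ y → iter f (toℕ (index y)) z ≡ y
    iter-index y = begin
      iter f (toℕ (index y)) z         ≡⟨ cong (λ k → iter f k z) (toℕ-fromℕ< (m%n<n (proj₁ (covers y)) m)) ⟩
      iter f (proj₁ (covers y) % m) z  ≡⟨ iter-% per (proj₁ (covers y)) ⟨
      iter f (proj₁ (covers y)) z      ≡⟨ proj₂ (covers y) ⟩
      y                                ∎

    index-injective : Injective _≡_ _≡_ index
    index-injective {x} {y} e = trans (sym (iter-index x)) (trans (cong (λ i → iter f (toℕ i) z) e) (iter-index y))

  period-suc-n : Covers → Period (suc n)
  period-suc-n covers with p , 0<p , p≤suc-n , per ← short-period =
    subst Period (≤-antisym p≤suc-n (suc-n≤period covers {{>-nonZero 0<p}} per)) per

  period-divisible : Covers → ∀ {m} → Period m → suc n ∣ m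
  period-divisible covers {m} per = m%n≡0⇒n∣m m (suc n) (remainder≡0 (m%n<n m (suc n)) remainder-period)
    where
    remainder-period : Period (m % suc n)
    remainder-period = trans (sym (iter-% (period-suc-n covers) m)) per

    remainder≡0 : ∀ {r} → r < suc n → Period r → r ≡ 0
    remainder≡0 {zero}  _   _   = refl
    remainder≡0 {suc r} r<n per = ⊥-elim (<⇒≱ r<n (suc-n≤period covers per))

module _ {m : ℕ} where

  toℕ-σ-< : (i : Fin (suc m)) → toℕ i < m → toℕ (σ i) ≡ suc (toℕ i)
  toℕ-σ-< i i<m = trans (toℕ-fromℕ< (m%n<n (suc (toℕ i)) (suc m))) (m<n⇒m%n≡m (s≤s i<m))

  toℕ-σ-last : (i : Fin (suc m)) → toℕ i ≡ m → toℕ (σ i) ≡ 0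
  toℕ-σ-last i i≡m = begin
    toℕ (σ i)            ≡⟨ toℕ-fromℕ< (m%n<n (suc (toℕ i)) (suc m)) ⟩
    suc (toℕ i) % suc m  ≡⟨ cong (λ t → suc t % suc m) i≡m ⟩
    suc m % suc m        ≡⟨ n%n≡0 (suc m) ⟩
    0                    ∎

  σ∘ρ∘σ≗ρ : (i : Fin (suc m)) → σ (ρ (σ i)) ≡ ρ i
  σ∘ρ∘σ≗ρ i with m≤n⇒m<n∨m≡n (toℕ≤pred[n] i)
  ... | inj₁ i<m = toℕ-injective (begin
    toℕ (σ (ρ (σ i)))       ≡⟨ toℕ-σ-< (ρ (σ i)) (subst (_< m) (sym toℕ-ρσi) (∸-monoʳ-< (s≤s z≤n) i<m)) ⟩
    suc (toℕ (ρ (σ i)))     ≡⟨ cong suc toℕ-ρσi ⟩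
    suc (m ∸ suc (toℕ i))   ≡⟨ +-∸-assoc 1 i<m ⟨
    m ∸ toℕ i               ≡⟨ opposite-prop i ⟨
    toℕ (ρ i)               ∎)
    where
    toℕ-ρσi : toℕ (ρ (σ i)) ≡ m ∸ suc (toℕ i)
    toℕ-ρσi = trans (opposite-prop (σ i)) (cong (m ∸_) (toℕ-σ-< i i<m))
  ... | inj₂ i≡m = toℕ-injective (begin
    toℕ (σ (ρ (σ i)))  ≡⟨ toℕ-σ-last (ρ (σ i)) (trans (opposite-prop (σ i)) (cong (m ∸_) (toℕ-σ-last i i≡m))) ⟩
    0                  ≡⟨ n∸n≡0 m ⟨
    m ∸ m              ≡⟨ cong (m ∸_) i≡m ⟨
    m ∸ toℕ i          ≡⟨ opposite-prop i ⟨
    toℕ (ρ i)          ∎)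

  σ∘ρ-zero : σ (ρ (Fin.zero {m})) ≡ Fin.zero
  σ∘ρ-zero = toℕ-injective (toℕ-σ-last (ρ Fin.zero) (opposite-prop Fin.zero))

  σ-injective : Injective _≡_ _≡_ (σ {suc m})
  σ-injective {a} {b} e = begin
    a               ≡⟨ opposite-involutive a ⟨
    ρ (ρ a)         ≡⟨ cong ρ (σ∘ρ∘σ≗ρ a) ⟨
    ρ (σ (ρ (σ a))) ≡⟨ cong (λ t → ρ (σ (ρ t))) e ⟩
    ρ (σ (ρ (σ b))) ≡⟨ cong ρ (σ∘ρ∘σ≗ρ b) ⟩
    ρ (ρ b)         ≡⟨ opposite-involutive b ⟩
    b               ∎

module FaceWalk {m : ℕ} (D : ChordDiagram (suc m)) where

  faceStep : Fin (suc m) → Fin (suc m)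
  faceStep z = σ (τ D z)

  τ-injective : Injective _≡_ _≡_ (τ D)
  τ-injective {a} {b} e = trans (sym (involutive D a)) (trans (cong (τ D) e) (involutive D b))

  faceStep-injective : Injective _≡_ _≡_ faceStep
  faceStep-injective e = τ-injective (σ-injective e)

  faceStep-reverses : InvariantUnder ρ D → ∀ y → faceStep (σ (ρ (faceStep y))) ≡ σ (ρ y)
  faceStep-reverses invariant y = cong σ (begin
    τ D (σ (ρ (σ (τ D y)))) ≡⟨ cong (τ D) (σ∘ρ∘σ≗ρ (τ D y)) ⟩
    τ D (ρ (τ D y))         ≡⟨ invariant (τ D y) ⟩
    ρ (τ D (τ D y))         ≡⟨ cong ρ (involutive D y) ⟩
    ρ y                     ∎)

  horizontal⇒odd-period : InvariantUnder ρ D → ∀ {x k} → τ D x ≡ ρ x →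
                          iter faceStep k Fin.zero ≡ x → iter faceStep (k + suc k) Fin.zero ≡ Fin.zero
  horizontal⇒odd-period invariant {x} {k} horizontal reach = begin
    iter faceStep (k + suc k) Fin.zero                        ≡⟨ iter-+ faceStep k (suc k) Fin.zero ⟩
    iter faceStep k (σ (τ D (iter faceStep k Fin.zero)))      ≡⟨ cong (λ t → iter faceStep k (σ (τ D t))) reach ⟩
    iter faceStep k (σ (τ D x))                           ≡⟨ cong (λ t → iter faceStep k (σ t)) horizontal ⟩
    iter faceStep k (σ (ρ x))                             ≡⟨ cong (λ t → iter faceStep k (σ (ρ t))) reach ⟨
    iter faceStep k (σ (ρ (iter faceStep k Fin.zero)))        ≡⟨ iter-reverses faceStep (λ t → σ (ρ t)) (faceStep-reverses invariant) k Fin.zero ⟩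
    σ (ρ Fin.zero)                                            ≡⟨ σ∘ρ-zero ⟩
    Fin.zero                                                  ∎

2∤n+[1+n] : ∀ n → 2 ∤ n + suc n
2∤n+[1+n] n (divides q e) = even≢odd q n (begin
  2 * q          ≡⟨ *-comm 2 q ⟩
  q * 2          ≡⟨ e ⟨
  n + suc n      ≡⟨ +-suc n n ⟩
  suc (n + n)    ≡⟨ cong (λ t → suc (n + t)) (+-identityʳ n) ⟨
  suc (2 * n)    ∎)

lemma1 : ∀ (g : ℕ) → 1 ≤ g → (D : ChordDiagram (4 * g)) →
    Maximal g D → InvariantUnder ρ D → ¬ HasHorizontalChord D
lemma1 zero    ()
lemma1 (suc g) _ D maximal invariant (x , horizontal) =
  2∤n+[1+n] k (∣-trans 2∣4g (period-divisible (maximal Fin.zero) odd-period))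
  where
  open FaceWalk D
  open Orbit faceStep faceStep-injective Fin.zero

  k : ℕ
  k = proj₁ (maximal Fin.zero x)

  odd-period : Period (k + suc k)
  odd-period = horizontal⇒odd-period invariant {k = k} horizontal (proj₂ (maximal Fin.zero x))

  2∣4g : 2 ∣ 4 * suc g
  2∣4g = ∣-trans (divides 2 refl) (m∣m*n (suc g))
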